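{- Let $q$ be a power of $3$, let $a,b\in\mathbb{F}_{q^2}^*$, and let $f(X)=X(1+aX^{q(q-1)}+bX^{2(q-1)})\in\mathbb{F}_{q^2}[X]$. Let $z\in\mathbb{F}_{q^2}\setminus\mathbb{F}_q$ and define \[ A(X)=(1+a^q+b^q)X^3+(z-z^q)X^2+(z^{2q}-z^{1+q})X+b^qz^3+a^qz^{3q}+z^{1+2q}, \] \[ B(X)=(1+a+b)X^3+(-z+z^q)X^2+(z^2-z^{1+q})X+az^3+bz^{3q}+z^{2+q}. \] Then $f(X)$ is a permutation polynomial of $\mathbb{F}_{q^2}$ if and only if (i) $B(X)$ has no root in $\mathbb{F}_q$, and (ii) for each $y\in\mathbb{F}_q$ there is a unique $x\in\mathbb{F}_q$ such that \[ (1+a+b)A(x)(y+z)-(1+a+b)^qB(x)(y+z^q)=0. \]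
   Context: A permutation polynomial of a finite field $F$ is a polynomial inducing a bijection $F\to F$. The field has characteristic $3$ throughout. -}

module Defs where

open import Level using (0ℓ)
open import Data.Nat using (ℕ; _∸_) renaming (_^_ to _^ℕ_; _*_ to _*ℕ_; _+_ to _+ℕ_)
open import Data.Fin using (Fin)
open import Data.Product using (Σ; ∃; _×_; _,_)
open import Relation.Nullary using (¬_)
open import Relation.Binary.PropositionalEquality using (_≡_)
open import Algebra.Bundles using (CommutativeRing; Semiring)

module FF (R : CommutativeRing 0ℓ 0ℓ) where
  open CommutativeRing R public
  open import Algebra.Definitions.RawSemiring (Semiring.rawSemiring semiring) public using (_^_)

  IsField : Set
  IsField = ¬ (1# ≈ 0#) × (∀ x → ¬ (x ≈ 0#) → ∃ λ y → x * y ≈ 1#)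

  HasSize : ℕ → Set
  HasSize n = Σ (Fin n → Carrier) λ e →
                (∀ i j → e i ≈ e j → i ≡ j) × (∀ x → ∃ λ i → e i ≈ x)

  Char3 : Set
  Char3 = 1# + 1# + 1# ≈ 0#

  IsPermutation : (Carrier → Carrier) → Set
  IsPermutation g = (∀ x y → g x ≈ g y → x ≈ y) × (∀ y → ∃ λ x → g x ≈ y)

  InSubfield : ℕ → Carrier → Set
  InSubfield q x = x ^ q ≈ x

  fPoly : ℕ → Carrier → Carrier → Carrier → Carrier
  fPoly q a b x = x * (1# + a * x ^ (q *ℕ (q ∸ 1)) + b * x ^ (2 *ℕ (q ∸ 1)))

  APoly : ℕ → Carrier → Carrier → Carrier → Carrier → Carrier
  APoly q a b z x =
    (1# + a ^ q + b ^ q) * x ^ 3 + (z - z ^ q) * x ^ 2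
    + (z ^ (2 *ℕ q) - z ^ (1 +ℕ q)) * x
    + b ^ q * z ^ 3 + a ^ q * z ^ (3 *ℕ q) + z ^ (1 +ℕ 2 *ℕ q)

  BPoly : ℕ → Carrier → Carrier → Carrier → Carrier → Carrier
  BPoly q a b z x =
    (1# + a + b) * x ^ 3 + (- z + z ^ q) * x ^ 2
    + (z ^ 2 - z ^ (1 +ℕ q)) * x
    + a * z ^ 3 + b * z ^ (3 *ℕ q) + z ^ (2 +ℕ q)

-- The Frobenius map φ w = w ^ q is an involution of F_{q²} with fixed field F_q, and since
-- w ^ (q²) = w, f w · w^(q+1) = w^(q+2) + a w^3 + b w^(3q) is a cubic form in (w, φ w). Hence
-- f (λ w) = λ f w for λ ∈ F_q, f λ = (1 + a + b) λ, and f (x + z) · N(x + z) = B x for x ∈ F_q,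
-- where N w = w φ(w) is the norm; moreover φ (B x) = A x. Every w ∉ F_q is s (x + z) with
-- s, x ∈ F_q and s ≠ 0, so f is onto iff for each y ∈ F_q some f (λ (x + z)) with λ ∈ F_q equals
-- (y + z) / (1 + a + b)^q. When B x ≠ 0 this happens iff N(x + z) (y + z) / ((1 + a + b)^q B x)
-- is fixed by φ, which is the equation of (ii); injectivity makes x unique, since λ (x + z)
-- determines x. Conversely injectivity follows from surjectivity by finiteness.
module Submission where

open import Level using (0ℓ)
open import Algebra.Bundles using (CommutativeRing; RawRing)
import Algebra.Properties.Ring
import Algebra.Properties.Semiring.Exp
import Algebra.Properties.CommutativeSemiring.Exp
import Algebra.Properties.CommutativeMonoid.Sum
import Algebra.Properties.CommutativeSemigroup
import Algebra.Solver.Ring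
open import Algebra.Solver.Ring.AlmostCommutativeRing
  using (fromCommutativeRing; _-Raw-AlmostCommutative⟶_)
open import Data.Empty using (⊥-elim)
open import Data.Fin using (Fin; zero; suc; punchIn; punchOut)
import Data.Fin.Properties as Fin
open import Data.Fin.Permutation using (Permutation; permutation; _⟨$⟩ʳ_; _⟨$⟩ˡ_; inverseʳ)
open import Data.Maybe using (Maybe; just; nothing)
open import Data.Nat using (ℕ; zero; suc; _∸_) renaming (_^_ to _^ℕ_; _*_ to _*ℕ_; _+_ to _+ℕ_)
import Data.Nat.Properties as ℕ
open import Data.Nat.Tactic.RingSolver using (solve-∀)
open import Data.Product using (Σ; ∃; ∃₂; _×_; _,_; proj₁; proj₂)
open import Data.Sum using (_⊎_; inj₁; inj₂)
open import Function.Definitions using (Injective)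
open import Relation.Nullary using (¬_; Dec; yes; no)
open import Relation.Binary.PropositionalEquality as ≡ using (_≡_; _≢_)
open import Defs

data 𝔽₃ : Set where
  0₃ 1₃ 2₃ : 𝔽₃

_+₃_ : 𝔽₃ → 𝔽₃ → 𝔽₃
0₃ +₃ y  = y
1₃ +₃ 0₃ = 1₃
1₃ +₃ 1₃ = 2₃
1₃ +₃ 2₃ = 0₃
2₃ +₃ 0₃ = 2₃
2₃ +₃ 1₃ = 0₃
2₃ +₃ 2₃ = 1₃

_*₃_ : 𝔽₃ → 𝔽₃ → 𝔽₃
0₃ *₃ y  = 0₃
1₃ *₃ y  = y
2₃ *₃ 0₃ = 0₃
2₃ *₃ 1₃ = 2₃
2₃ *₃ 2₃ = 1₃

-₃_ : 𝔽₃ → 𝔽₃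
-₃ 0₃ = 0₃
-₃ 1₃ = 2₃
-₃ 2₃ = 1₃

𝔽₃-rawRing : RawRing 0ℓ 0ℓ
𝔽₃-rawRing = record
  { Carrier = 𝔽₃ ; _≈_ = _≡_ ; _+_ = _+₃_ ; _*_ = _*₃_ ; -_ = -₃_ ; 0# = 0₃ ; 1# = 1₃ }

-- Coefficients in 𝔽₃, so that identities such as (x + y)^3 = x^3 + y^3 can be normalised.
module Char3Solver (R : CommutativeRing 0ℓ 0ℓ) (char3 : FF.Char3 R) where
  open CommutativeRing R
  open Algebra.Properties.Ring ring using (-1*x≈-x; -‿involutive; -‿anti-homo-+; +-inverseˡ-unique; -0#≈0#)

  ⟦_⟧ : 𝔽₃ → Carrier
  ⟦ 0₃ ⟧ = 0#
  ⟦ 1₃ ⟧ = 1#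
  ⟦ 2₃ ⟧ = - 1#

  1+1≈-1 : 1# + 1# ≈ - 1#
  1+1≈-1 = +-inverseˡ-unique (1# + 1#) 1# char3

  -1+-1≈1 : - 1# + - 1# ≈ 1#
  -1+-1≈1 = trans (sym (-‿anti-homo-+ 1# 1#)) (trans (-‿cong 1+1≈-1) (-‿involutive 1#))

  ⟦⟧-+ : ∀ x y → ⟦ x +₃ y ⟧ ≈ ⟦ x ⟧ + ⟦ y ⟧
  ⟦⟧-+ 0₃ y  = sym (+-identityˡ _)
  ⟦⟧-+ 1₃ 0₃ = sym (+-identityʳ _)
  ⟦⟧-+ 1₃ 1₃ = sym 1+1≈-1
  ⟦⟧-+ 1₃ 2₃ = sym (-‿inverseʳ 1#)
  ⟦⟧-+ 2₃ 0₃ = sym (+-identityʳ _)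
  ⟦⟧-+ 2₃ 1₃ = sym (-‿inverseˡ 1#)
  ⟦⟧-+ 2₃ 2₃ = sym -1+-1≈1

  ⟦⟧-* : ∀ x y → ⟦ x *₃ y ⟧ ≈ ⟦ x ⟧ * ⟦ y ⟧
  ⟦⟧-* 0₃ y  = sym (zeroˡ _)
  ⟦⟧-* 1₃ y  = sym (*-identityˡ _)
  ⟦⟧-* 2₃ 0₃ = sym (zeroʳ _)
  ⟦⟧-* 2₃ 1₃ = sym (*-identityʳ _)
  ⟦⟧-* 2₃ 2₃ = sym (trans (-1*x≈-x (- 1#)) (-‿involutive 1#))

  ⟦⟧-‿ : ∀ x → ⟦ -₃ x ⟧ ≈ - ⟦ x ⟧
  ⟦⟧-‿ 0₃ = sym -0#≈0#
  ⟦⟧-‿ 1₃ = refl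
  ⟦⟧-‿ 2₃ = sym (-‿involutive 1#)

  ⟦⟧-homomorphism : 𝔽₃-rawRing -Raw-AlmostCommutative⟶ fromCommutativeRing R
  ⟦⟧-homomorphism = record
    { ⟦_⟧ = ⟦_⟧ ; +-homo = ⟦⟧-+ ; *-homo = ⟦⟧-* ; -‿homo = ⟦⟧-‿ ; 0-homo = refl ; 1-homo = refl }

  ⟦⟧-≟ : ∀ x y → Maybe (⟦ x ⟧ ≈ ⟦ y ⟧)
  ⟦⟧-≟ 0₃ 0₃ = just refl
  ⟦⟧-≟ 1₃ 1₃ = just refl
  ⟦⟧-≟ 2₃ 2₃ = just refl
  ⟦⟧-≟ _  _  = nothing

  open Algebra.Solver.Ring 𝔽₃-rawRing (fromCommutativeRing R) ⟦⟧-homomorphism ⟦⟧-≟ public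
    using (solve; _:=_; _:+_; _:*_; :-_; _:-_; _:^_; con)

Fin-injective⇒surjective : ∀ {n} (σ : Fin n → Fin n) → Injective _≡_ _≡_ σ → ∀ j → ∃ λ i → σ i ≡ j
Fin-injective⇒surjective {suc m} σ σ-injective j with Fin.any? (λ i → σ i Fin.≟ j)
... | yes hit = hit
... | no miss = ⊥-elim (ℕ.<-irrefl ≡.refl (Fin.injective⇒≤ τ-injective))
  where
  j≢σ : ∀ i → j ≢ σ i
  j≢σ i j≡σi = miss (i , ≡.sym j≡σi)
  τ : Fin (suc m) → Fin m
  τ i = punchOut (j≢σ i)
  τ-injective : Injective _≡_ _≡_ τ
  τ-injective {i} {i′} eq = σ-injective (Fin.punchOut-injective (j≢σ i) (j≢σ i′) eq)

Fin-injective⇒permutation : ∀ {n} (σ : Fin n → Fin n) → Injective _≡_ _≡_ σ → Permutation n n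
Fin-injective⇒permutation σ σ-injective =
  permutation σ (λ j → proj₁ (surj j)) (λ j → proj₂ (surj j)) (λ i → σ-injective (proj₂ (surj (σ i))))
  where
  surj : ∀ j → ∃ λ i → σ i ≡ j
  surj = Fin-injective⇒surjective σ σ-injective

module FieldProperties (R : CommutativeRing 0ℓ 0ℓ) (isField : FF.IsField R) where
  open FF R hiding (zero)
  open import Relation.Binary.Reasoning.Setoid setoid

  1≉0 : 1# ≉ 0#
  1≉0 = proj₁ isField

  _⁻¹⟨_⟩ : (x : Carrier) → x ≉ 0# → Carrier
  x ⁻¹⟨ x≉0 ⟩ = proj₁ (proj₂ isField x x≉0)

  *-inverseʳ : ∀ x (x≉0 : x ≉ 0#) → x * x ⁻¹⟨ x≉0 ⟩ ≈ 1#
  *-inverseʳ x x≉0 = proj₂ (proj₂ isField x x≉0)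

  *-inverseˡ : ∀ x (x≉0 : x ≉ 0#) → x ⁻¹⟨ x≉0 ⟩ * x ≈ 1#
  *-inverseˡ x x≉0 = trans (*-comm _ x) (*-inverseʳ x x≉0)

  *-inverse-cancelʳ : ∀ x {d} (d≉0 : d ≉ 0#) → x * d ⁻¹⟨ d≉0 ⟩ * d ≈ x
  *-inverse-cancelʳ x {d} d≉0 = trans (*-assoc x _ d) (trans (*-congˡ (*-inverseˡ d d≉0)) (*-identityʳ x))

  *-cancelʳ : ∀ {d} → d ≉ 0# → ∀ {x y} → x * d ≈ y * d → x ≈ y
  *-cancelʳ {d} d≉0 {x} {y} xd≈yd = begin
    x                     ≈⟨ *-identityʳ x ⟨
    x * 1#                ≈⟨ *-congˡ (*-inverseʳ d d≉0) ⟨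
    x * (d * d ⁻¹⟨ d≉0 ⟩)  ≈⟨ *-assoc x d _ ⟨
    x * d * d ⁻¹⟨ d≉0 ⟩    ≈⟨ *-congʳ xd≈yd ⟩
    y * d * d ⁻¹⟨ d≉0 ⟩    ≈⟨ *-assoc y d _ ⟩
    y * (d * d ⁻¹⟨ d≉0 ⟩)  ≈⟨ *-congˡ (*-inverseʳ d d≉0) ⟩
    y * 1#                ≈⟨ *-identityʳ y ⟩
    y                     ∎

  x*y≈0⇒y≈0 : ∀ {x y} → x ≉ 0# → x * y ≈ 0# → y ≈ 0#
  x*y≈0⇒y≈0 {x} {y} x≉0 xy≈0 = *-cancelʳ x≉0 (trans (*-comm y x) (trans xy≈0 (sym (zeroˡ x))))

  *-nonzero : ∀ {x y} → x ≉ 0# → y ≉ 0# → x * y ≉ 0#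
  *-nonzero x≉0 y≉0 xy≈0 = y≉0 (x*y≈0⇒y≈0 x≉0 xy≈0)

module FiniteCarrier (R : CommutativeRing 0ℓ 0ℓ) {n : ℕ} (size : FF.HasSize R n) where
  open FF R hiding (zero)

  enum : Fin n → Carrier
  enum = proj₁ size

  enum-injective : ∀ i j → enum i ≈ enum j → i ≡ j
  enum-injective = proj₁ (proj₂ size)

  index : Carrier → Fin n
  index x = proj₁ (proj₂ (proj₂ size) x)

  enum-index : ∀ x → enum (index x) ≈ x
  enum-index x = proj₂ (proj₂ (proj₂ size) x)

  index-cong : ∀ {x y} → x ≈ y → index x ≡ index y
  index-cong {x} {y} x≈y = enum-injective _ _ (trans (enum-index x) (trans x≈y (sym (enum-index y))))

  _≟_ : ∀ x y → Dec (x ≈ y)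
  x ≟ y with index x Fin.≟ index y
  ... | yes ix≡iy = yes (trans (sym (enum-index x)) (trans (reflexive (≡.cong enum ix≡iy)) (enum-index y)))
  ... | no  ix≢iy = no λ x≈y → ix≢iy (index-cong x≈y)

  reindex : (G : Carrier → Carrier) → (∀ x y → G x ≈ G y → x ≈ y) →
            Σ (Permutation n n) λ π → ∀ i → enum (π ⟨$⟩ʳ i) ≈ G (enum i)
  reindex G G-injective = Fin-injective⇒permutation σ σ-injective , λ i → enum-index (G (enum i))
    where
    σ : Fin n → Fin n
    σ i = index (G (enum i))
    σ-injective : Injective _≡_ _≡_ σ
    σ-injective {i} {j} σi≡σj = enum-injective i j (G-injective _ _
      (trans (sym (enum-index _)) (trans (reflexive (≡.cong enum σi≡σj)) (enum-index _))))

  injective⇒surjective : (G : Carrier → Carrier) → (∀ x y → G x ≈ G y → x ≈ y) →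
                         ∀ y → ∃ λ x → G x ≈ y
  injective⇒surjective G G-injective y =
    let π , enum-π = reindex G G-injective
    in enum (π ⟨$⟩ˡ index y) ,
       trans (sym (enum-π _)) (trans (reflexive (≡.cong enum (inverseʳ π))) (enum-index y))

  -- The section is made to factor through index so that it respects ≈.
  surjective⇒injective : (F : Carrier → Carrier) → (∀ {x y} → x ≈ y → F x ≈ F y) →
                         (∀ y → ∃ λ x → F x ≈ y) → ∀ x y → F x ≈ F y → x ≈ y
  surjective⇒injective F F-cong F-surjective x y Fx≈Fy =
    trans (section∘F x) (trans (section-cong Fx≈Fy) (sym (section∘F y)))
    where
    section : Carrier → Carrier
    section t = proj₁ (F-surjective (enum (index t)))
    section-cong : ∀ {s t} → s ≈ t → section s ≈ section t
    section-cong s≈t = reflexive (≡.cong (λ i → proj₁ (F-surjective (enum i))) (index-cong s≈t))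
    F-section : ∀ t → F (section t) ≈ t
    F-section t = trans (proj₂ (F-surjective (enum (index t)))) (enum-index t)
    section∘F : ∀ x → x ≈ section (F x)
    section∘F x =
      let t , st≈x = injective⇒surjective section
                       (λ s t eq → trans (sym (F-section s)) (trans (F-cong eq) (F-section t))) x
      in trans (sym st≈x) (section-cong (trans (sym (F-section t)) (F-cong st≈x)))

module FermatLittle (R : CommutativeRing 0ℓ 0ℓ) (isField : FF.IsField R) {n : ℕ} (size : FF.HasSize R n) where
  open FF R hiding (zero)
  open FieldProperties R isField
  open FiniteCarrier R size
  open Algebra.Properties.CommutativeMonoid.Sum *-commutativeMonoid
    using () renaming (sum to ∏; sum-cong-≋ to ∏-cong; ∑-distrib-+ to ∏-distrib-*;
                       sum-permute to ∏-permute; sum-replicate to ∏-replicate;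
                       sum-replicate-zero to ∏-replicate-one; sum-remove to ∏-remove)
  open import Relation.Binary.Reasoning.Setoid setoid

  ∏-single : ∀ {m} (f : Fin m → Carrier) i → (∀ j → j ≢ i → f j ≈ 1#) → ∏ f ≈ f i
  ∏-single {suc m} f i rest≈1 = begin
    ∏ f                           ≈⟨ ∏-remove f ⟩
    f i * ∏ (λ j → f (punchIn i j))  ≈⟨ *-congˡ (∏-cong λ j → rest≈1 _ (Fin.punchInᵢ≢i i j)) ⟩
    f i * ∏ {m} (λ _ → 1#)         ≈⟨ *-congˡ (∏-replicate-one m) ⟩
    f i * 1#                      ≈⟨ *-identityʳ (f i) ⟩
    f i                           ∎

  ∏-nonzero : ∀ {m} (f : Fin m → Carrier) → (∀ i → f i ≉ 0#) → ∏ f ≉ 0#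
  ∏-nonzero {zero}  f f≉0 = 1≉0
  ∏-nonzero {suc m} f f≉0 = *-nonzero (f≉0 zero) (∏-nonzero (λ i → f (suc i)) (λ i → f≉0 (suc i)))

  ifZero : Carrier → Carrier → Carrier → Carrier
  ifZero y u v with y ≟ 0#
  ... | yes _ = u
  ... | no  _ = v

  ifZero-≈0 : ∀ {y} u v → y ≈ 0# → ifZero y u v ≈ u
  ifZero-≈0 {y} u v y≈0 with y ≟ 0#
  ... | yes _   = refl
  ... | no  y≉0 = ⊥-elim (y≉0 y≈0)

  ifZero-≉0 : ∀ {y} u v → y ≉ 0# → ifZero y u v ≈ v
  ifZero-≉0 {y} u v y≉0 with y ≟ 0#
  ... | yes y≈0 = ⊥-elim (y≉0 y≈0)
  ... | no  _   = refl

  nonzeroPart : Carrier → Carrier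
  nonzeroPart y = ifZero y 1# y

  nonzeroPart-cong : ∀ {y y′} → y ≈ y′ → nonzeroPart y ≈ nonzeroPart y′
  nonzeroPart-cong {y} {y′} y≈y′ with y ≟ 0#
  ... | yes y≈0 = sym (ifZero-≈0 1# y′ (trans (sym y≈y′) y≈0))
  ... | no  y≉0 = trans y≈y′ (sym (ifZero-≉0 1# y′ λ y′≈0 → y≉0 (trans y≈y′ y′≈0)))

  nonzeroPart-≉0 : ∀ y → nonzeroPart y ≉ 0#
  nonzeroPart-≉0 y with y ≟ 0#
  ... | yes _   = 1≉0
  ... | no  y≉0 = y≉0

  nonzeroPart-* : ∀ {x} → x ≉ 0# → ∀ y → nonzeroPart (x * y) ≈ ifZero y 1# x * nonzeroPart y
  nonzeroPart-* {x} x≉0 y with y ≟ 0#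
  ... | yes y≈0 = trans (ifZero-≈0 1# _ (trans (*-congˡ y≈0) (zeroʳ x))) (sym (*-identityˡ 1#))
  ... | no  y≉0 = ifZero-≉0 1# _ (*-nonzero x≉0 y≉0)

  -- For x ≉ 0, multiplication by x permutes the field, so the product of the nonzero parts is
  -- unchanged by it; hence ∏ K = 1, i.e. x ^ (n - 1) = 1.
  fermat : ∀ x → x ^ n ≈ x
  fermat x with x ≟ 0#
  ... | yes x≈0 = ≈0⇒^≈ (index x) x≈0
    where
    ≈0⇒^≈ : ∀ {m} → Fin m → x ≈ 0# → x ^ m ≈ x
    ≈0⇒^≈ {suc m} _ x≈0 = trans (trans (*-congʳ x≈0) (zeroˡ _)) (sym x≈0)
  ... | no  x≉0 = begin
    x ^ n                  ≈⟨ ∏-replicate n ⟨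
    ∏ {n} (λ _ → x)        ≈⟨ ∏-cong K*L≈x ⟨
    ∏ (λ i → K i * L i)    ≈⟨ ∏-distrib-* K L ⟩
    ∏ K * ∏ L              ≈⟨ *-cong ∏K≈1 ∏L≈x ⟩
    1# * x                 ≈⟨ *-identityˡ x ⟩
    x                      ∎
    where
    K L N : Fin n → Carrier
    K i = ifZero (enum i) 1# x
    L i = ifZero (enum i) x 1#
    N i = nonzeroPart (enum i)
    K*L≈x : ∀ i → K i * L i ≈ x
    K*L≈x i with enum i ≟ 0#
    ... | yes _ = *-identityˡ x
    ... | no  _ = *-identityʳ x
    ∏K≈1 : ∏ K ≈ 1#
    ∏K≈1 = *-cancelʳ (∏-nonzero N (λ i → nonzeroPart-≉0 (enum i))) (begin
      ∏ K * ∏ N              ≈⟨ ∏-distrib-* K N ⟨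
      ∏ (λ i → K i * N i)    ≈⟨ ∏-cong (λ i → nonzeroPart-* x≉0 (enum i)) ⟨
      ∏ (λ i → nonzeroPart (x * enum i))  ≈⟨ ∏-cong (λ i → nonzeroPart-cong (proj₂ π i)) ⟨
      ∏ (λ i → N (proj₁ π ⟨$⟩ʳ i))         ≈⟨ ∏-permute N (proj₁ π) ⟨
      ∏ N                    ≈⟨ *-identityˡ (∏ N) ⟨
      1# * ∏ N               ∎)
      where
      x*-injective : ∀ a b → x * a ≈ x * b → a ≈ b
      x*-injective a b eq = *-cancelʳ x≉0 (trans (*-comm a x) (trans eq (*-comm x b)))
      π : Σ (Permutation n n) λ π → ∀ i → enum (π ⟨$⟩ʳ i) ≈ x * enum i
      π = reindex (x *_) x*-injective
    ∏L≈x : ∏ L ≈ x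
    ∏L≈x = trans (∏-single L i₀ L≈1) (ifZero-≈0 x 1# (enum-index 0#))
      where
      i₀ : Fin n
      i₀ = index 0#
      L≈1 : ∀ j → j ≢ i₀ → L j ≈ 1#
      L≈1 j j≢i₀ = ifZero-≉0 x 1# λ ej≈0 → j≢i₀ (enum-injective _ _ (trans ej≈0 (sym (enum-index 0#))))

module Char3Frobenius (R : CommutativeRing 0ℓ 0ℓ) (char3 : FF.Char3 R) where
  open FF R hiding (zero)
  open Char3Solver R char3
  open Algebra.Properties.Semiring.Exp semiring using (^-congˡ; ^-assocʳ)
  open import Relation.Binary.Reasoning.Setoid setoid

  ^3-additive : ∀ x y → (x + y) ^ 3 ≈ x ^ 3 + y ^ 3
  ^3-additive = solve 2 (λ x y → (x :+ y) :^ 3 := x :^ 3 :+ y :^ 3) refl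

  ^3ᵏ-additive : ∀ k x y → (x + y) ^ (3 ^ℕ k) ≈ x ^ (3 ^ℕ k) + y ^ (3 ^ℕ k)
  ^3ᵏ-additive zero x y = trans (*-identityʳ _) (sym (+-cong (*-identityʳ x) (*-identityʳ y)))
  ^3ᵏ-additive (suc k) x y = begin
    (x + y) ^ (3 *ℕ 3 ^ℕ k)               ≈⟨ ^-assocʳ (x + y) 3 (3 ^ℕ k) ⟨
    ((x + y) ^ 3) ^ (3 ^ℕ k)              ≈⟨ ^-congˡ (3 ^ℕ k) (^3-additive x y) ⟩
    (x ^ 3 + y ^ 3) ^ (3 ^ℕ k)            ≈⟨ ^3ᵏ-additive k (x ^ 3) (y ^ 3) ⟩
    (x ^ 3) ^ (3 ^ℕ k) + (y ^ 3) ^ (3 ^ℕ k)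
      ≈⟨ +-cong (^-assocʳ x 3 (3 ^ℕ k)) (^-assocʳ y 3 (3 ^ℕ k)) ⟩
    x ^ (3 *ℕ 3 ^ℕ k) + y ^ (3 *ℕ 3 ^ℕ k) ∎

3^k≡suc : ∀ k → ∃ λ m → 3 ^ℕ k ≡ suc m
3^k≡suc zero = 0 , ≡.refl
3^k≡suc (suc k) with m , eq ← 3^k≡suc k rewrite eq = _ , ≡.refl

module Frobenius (R : CommutativeRing 0ℓ 0ℓ) (isField : FF.IsField R) (char3 : FF.Char3 R)
                 {q k : ℕ} (q≡3^k : q ≡ 3 ^ℕ k) (size : FF.HasSize R (q *ℕ q)) where
  open FF R hiding (zero)
  open FieldProperties R isField
  open FiniteCarrier R size using (_≟_)
  open FermatLittle R isField size using (fermat)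
  open Char3Solver R char3
  open Algebra.Properties.Ring ring using (+-inverseˡ-unique; x∙y⁻¹≈ε⇒x≈y; x≈y⇒x∙y⁻¹≈ε)
  open Algebra.Properties.Semiring.Exp semiring using (^-congˡ; ^-assocʳ; ^-homo-*)
  open Algebra.Properties.CommutativeSemiring.Exp commutativeSemiring using (^-distrib-*)
  open Algebra.Properties.CommutativeSemigroup *-commutativeSemigroup using (interchange)
  open import Relation.Binary.Reasoning.Setoid setoid

  q≡suc : ∃ λ m → q ≡ suc m
  q≡suc = let m , 3^k≡1+m = 3^k≡suc k in m , ≡.trans q≡3^k 3^k≡1+m

  φ : Carrier → Carrier
  φ x = x ^ q

  Fq : Carrier → Set
  Fq = InSubfield q

  φ-cong : ∀ {x y} → x ≈ y → φ x ≈ φ y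
  φ-cong = ^-congˡ q

  φ-+ : ∀ x y → φ (x + y) ≈ φ x + φ y
  φ-+ = ≡.subst (λ n → ∀ x y → (x + y) ^ n ≈ x ^ n + y ^ n) (≡.sym q≡3^k)
                (Char3Frobenius.^3ᵏ-additive R char3 k)

  φ-* : ∀ x y → φ (x * y) ≈ φ x * φ y
  φ-* x y = ^-distrib-* x y q

  φ-0 : φ 0# ≈ 0#
  φ-0 = ≡.subst (λ n → 0# ^ n ≈ 0#) (≡.sym (proj₂ q≡suc)) (zeroˡ _)

  φ-1 : φ 1# ≈ 1#
  φ-1 = 1^q q
    where
    1^q : ∀ n → 1# ^ n ≈ 1#
    1^q zero    = refl
    1^q (suc n) = trans (*-identityˡ _) (1^q n)

  φ-‿ : ∀ x → φ (- x) ≈ - φ x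
  φ-‿ x = +-inverseˡ-unique (φ (- x)) (φ x)
    (trans (sym (φ-+ (- x) x)) (trans (φ-cong (-‿inverseˡ x)) φ-0))

  φ-involutive : ∀ x → φ (φ x) ≈ x
  φ-involutive x = trans (^-assocʳ x q q) (fermat x)

  φ-≉0 : ∀ {x} → x ≉ 0# → φ x ≉ 0#
  φ-≉0 {x} x≉0 φx≈0 = x≉0 (trans (sym (φ-involutive x)) (trans (φ-cong φx≈0) φ-0))

  Fq-resp : ∀ {x y} → x ≈ y → Fq x → Fq y
  Fq-resp x≈y φx≈x = trans (φ-cong (sym x≈y)) (trans φx≈x x≈y)

  Fq-0 : Fq 0#
  Fq-0 = φ-0

  Fq-1 : Fq 1#
  Fq-1 = φ-1

  Fq-+ : ∀ {x y} → Fq x → Fq y → Fq (x + y)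
  Fq-+ Fx Fy = trans (φ-+ _ _) (+-cong Fx Fy)

  Fq-* : ∀ {x y} → Fq x → Fq y → Fq (x * y)
  Fq-* Fx Fy = trans (φ-* _ _) (*-cong Fx Fy)

  Fq-‿ : ∀ {x} → Fq x → Fq (- x)
  Fq-‿ Fx = trans (φ-‿ _) (-‿cong Fx)

  Fq-/ : ∀ {u K} (K≉0 : K ≉ 0#) → u * φ K ≈ φ u * K → Fq (u * K ⁻¹⟨ K≉0 ⟩)
  Fq-/ {u} {K} K≉0 uφK≈φuK = *-cancelʳ (*-nonzero K≉0 (φ-≉0 K≉0)) (begin
    φ (u * K⁻¹) * (K * φ K)      ≈⟨ *-congʳ (φ-* u K⁻¹) ⟩
    φ u * φ K⁻¹ * (K * φ K)      ≈⟨ interchange (φ u) (φ K⁻¹) K (φ K) ⟩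
    φ u * K * (φ K⁻¹ * φ K)      ≈⟨ *-congˡ (trans (sym (φ-* K⁻¹ K))
                                             (trans (φ-cong (*-inverseˡ K K≉0)) φ-1)) ⟩
    φ u * K * 1#                 ≈⟨ *-congʳ uφK≈φuK ⟨
    u * φ K * 1#                 ≈⟨ *-congˡ (*-inverseˡ K K≉0) ⟨
    u * φ K * (K⁻¹ * K)          ≈⟨ interchange u (φ K) K⁻¹ K ⟩
    u * K⁻¹ * (φ K * K)          ≈⟨ *-congˡ (*-comm (φ K) K) ⟩
    u * K⁻¹ * (K * φ K)          ∎)
    where K⁻¹ = K ⁻¹⟨ K≉0 ⟩

  Fq-inverse : ∀ {x} (x≉0 : x ≉ 0#) → Fq x → Fq (x ⁻¹⟨ x≉0 ⟩)
  Fq-inverse {x} x≉0 Fx = Fq-resp (*-identityˡ _) (Fq-/ x≉0 (trans (*-congˡ Fx) (*-congʳ (sym φ-1))))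

  norm : Carrier → Carrier
  norm w = w * φ w

  Fq-norm : ∀ w → Fq (norm w)
  Fq-norm w = trans (φ-* w (φ w)) (trans (*-congˡ (φ-involutive w)) (*-comm _ _))

  q*[q∸1]+q≡q*q : q *ℕ (q ∸ 1) +ℕ q ≡ q *ℕ q
  q*[q∸1]+q≡q*q = ≡.subst (λ n → n *ℕ (n ∸ 1) +ℕ n ≡ n *ℕ n)
                          (≡.sym (proj₂ q≡suc)) (identity (proj₁ q≡suc))
    where
    identity : ∀ m → suc m *ℕ m +ℕ suc m ≡ suc m *ℕ suc m
    identity = solve-∀

  2*[q∸1]+2≡q+q : 2 *ℕ (q ∸ 1) +ℕ 2 ≡ q +ℕ q
  2*[q∸1]+2≡q+q = ≡.subst (λ n → 2 *ℕ (n ∸ 1) +ℕ 2 ≡ n +ℕ n)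
                          (≡.sym (proj₂ q≡suc)) (identity (proj₁ q≡suc))
    where
    identity : ∀ m → 2 *ℕ m +ℕ 2 ≡ suc m +ℕ suc m
    identity = solve-∀

  ^[q*[q∸1]]*φ≈id : ∀ w → w ^ (q *ℕ (q ∸ 1)) * φ w ≈ w
  ^[q*[q∸1]]*φ≈id w = begin
    w ^ (q *ℕ (q ∸ 1)) * w ^ q  ≈⟨ ^-homo-* w (q *ℕ (q ∸ 1)) q ⟨
    w ^ (q *ℕ (q ∸ 1) +ℕ q)     ≡⟨ ≡.cong (w ^_) q*[q∸1]+q≡q*q ⟩
    w ^ (q *ℕ q)                ≈⟨ fermat w ⟩
    w                           ∎

  ^[2*[q∸1]]*²≈φ² : ∀ w → w ^ (2 *ℕ (q ∸ 1)) * (w * w) ≈ φ w * φ w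
  ^[2*[q∸1]]*²≈φ² w = begin
    w ^ (2 *ℕ (q ∸ 1)) * (w * w)   ≈⟨ *-congˡ (*-congˡ (*-identityʳ w)) ⟨
    w ^ (2 *ℕ (q ∸ 1)) * w ^ 2     ≈⟨ ^-homo-* w (2 *ℕ (q ∸ 1)) 2 ⟨
    w ^ (2 *ℕ (q ∸ 1) +ℕ 2)        ≡⟨ ≡.cong (w ^_) 2*[q∸1]+2≡q+q ⟩
    w ^ (q +ℕ q)                   ≈⟨ ^-homo-* w q q ⟩
    φ w * φ w                      ∎

  module _ {z : Carrier} (z∉Fq : ¬ Fq z) where

    +-∉Fq : ∀ {y} → Fq y → ¬ Fq (y + z)
    +-∉Fq {y} Fy Fy+z = z∉Fq (Fq-resp (solve 2 (λ y z → (y :+ z) :- y := z) refl y z) (Fq-+ Fy+z (Fq-‿ Fy)))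

    *z∈Fq⇒≈0 : ∀ {m r} → Fq m → Fq r → m * z ≈ r → m ≈ 0#
    *z∈Fq⇒≈0 {m} {r} Fm Fr mz≈r with m ≟ 0#
    ... | yes m≈0 = m≈0
    ... | no  m≉0 = ⊥-elim (z∉Fq (Fq-resp z≈r/m (Fq-* Fr (Fq-inverse m≉0 Fm))))
      where
      z≈r/m : r * m ⁻¹⟨ m≉0 ⟩ ≈ z
      z≈r/m = *-cancelʳ m≉0 (begin
        r * m ⁻¹⟨ m≉0 ⟩ * m     ≈⟨ *-inverse-cancelʳ r m≉0 ⟩
        r                      ≈⟨ mz≈r ⟨
        m * z                  ≈⟨ *-comm m z ⟩
        z * m                  ∎)

    private
      d : Carrier
      d = z - φ z

      d≉0 : d ≉ 0#
      d≉0 d≈0 = z∉Fq (sym (x∙y⁻¹≈ε⇒x≈y z (φ z) d≈0))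

      φ[x-φx] : ∀ x → φ (x - φ x) ≈ φ x - x
      φ[x-φx] x = trans (φ-+ x (- φ x)) (+-congˡ (trans (φ-‿ (φ x)) (-‿cong (φ-involutive x))))

    -- Applying φ to w = u + s z gives w - φ w = s (z - φ z).
    coordinates : ∀ w → ∃₂ λ u s → Fq u × Fq s × w ≈ u + s * z
    coordinates w = u , s , Fu , Fs , solve 3 (λ w s z → w := (w :- s :* z) :+ s :* z) refl w s z
      where
      s u : Carrier
      s = (w - φ w) * d ⁻¹⟨ d≉0 ⟩
      u = w - s * z
      Fs : Fq s
      Fs = Fq-/ d≉0 (begin
        (w - φ w) * φ d         ≈⟨ *-congˡ (φ[x-φx] z) ⟩
        (w - φ w) * (φ z - z)   ≈⟨ solve 4 (λ w φw z φz → (w :- φw) :* (φz :- z) := (φw :- w) :* (z :- φz))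
                                            refl w (φ w) z (φ z) ⟩
        (φ w - w) * d           ≈⟨ *-congʳ (φ[x-φx] w) ⟨
        φ (w - φ w) * d         ∎)
      Fu : Fq u
      Fu = begin
        φ (w - s * z)           ≈⟨ trans (φ-+ w _) (+-congˡ (trans (φ-‿ _) (-‿cong (trans (φ-* s z) (*-congʳ Fs))))) ⟩
        φ w - s * φ z           ≈⟨ solve 5 (λ w φw s z φz → φw :- s :* φz := (w :- s :* z) :+ (s :* (z :- φz) :- (w :- φw)))
                                            refl w (φ w) s z (φ z) ⟩
        u + (s * d - (w - φ w)) ≈⟨ +-congˡ (x≈y⇒x∙y⁻¹≈ε (*-inverse-cancelʳ (w - φ w) d≉0)) ⟩
        u + 0#                  ≈⟨ +-identityʳ u ⟩
        u                       ∎

    ScaledShift : Carrier → Set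
    ScaledShift w = ∃₂ λ s x → Fq s × s ≉ 0# × Fq x × w ≈ s * (x + z)

    decompose : ∀ w → Fq w ⊎ ScaledShift w
    decompose w = split (coordinates w)
      where
      split : (∃₂ λ u s → Fq u × Fq s × w ≈ u + s * z) → Fq w ⊎ ScaledShift w
      split (u , s , Fu , Fs , w≈u+sz) with s ≟ 0#
      ... | yes s≈0 = inj₁ (Fq-resp (sym w≈u) Fu)
        where
        w≈u : w ≈ u
        w≈u = trans w≈u+sz (trans (+-congˡ (trans (*-congʳ s≈0) (zeroˡ z))) (+-identityʳ u))
      ... | no  s≉0 = inj₂ (s , u * s ⁻¹⟨ s≉0 ⟩ , Fs , s≉0 , Fq-* Fu (Fq-inverse s≉0 Fs) , (begin
        w                              ≈⟨ w≈u+sz ⟩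
        u + s * z                      ≈⟨ +-congʳ (*-inverse-cancelʳ u s≉0) ⟨
        u * s ⁻¹⟨ s≉0 ⟩ * s + s * z     ≈⟨ +-congʳ (*-comm _ s) ⟩
        s * (u * s ⁻¹⟨ s≉0 ⟩) + s * z   ≈⟨ distribˡ s _ z ⟨
        s * (u * s ⁻¹⟨ s≉0 ⟩ + z)       ∎))

module PermutationCriterion
  (R : CommutativeRing 0ℓ 0ℓ) (isField : FF.IsField R) (char3 : FF.Char3 R)
  {q k : ℕ} (q≡3^k : q ≡ 3 ^ℕ k) (size : FF.HasSize R (q *ℕ q))
  (a b z : CommutativeRing.Carrier R) (z∉Fq : ¬ FF.InSubfield R q z) where

  open FF R hiding (zero)
  open FieldProperties R isField
  open FiniteCarrier R size using (_≟_; surjective⇒injective)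
  open Frobenius R isField char3 {k = k} q≡3^k size
  open Char3Solver R char3
  open Algebra.Properties.Ring ring using (x∙y⁻¹≈ε⇒x≈y; x≈y⇒x∙y⁻¹≈ε; +-cancelʳ)
  open Algebra.Properties.Semiring.Exp semiring using (^-congˡ; ^-assocʳ)
  open Algebra.Properties.CommutativeSemigroup *-commutativeSemigroup using (xy∙z≈x∙zy; x∙yz≈xz∙y)
  open import Relation.Binary.Reasoning.Setoid setoid

  f : Carrier → Carrier
  f = fPoly q a b

  c : Carrier
  c = 1# + a + b

  A B : Carrier → Carrier
  A = APoly q a b z
  B = BPoly q a b z

  Condition : Carrier → Carrier → Set
  Condition y x = c * A x * (y + z) - φ c * B x * (y + φ z) ≈ 0#

  NoRootInFq : (Carrier → Carrier) → Set
  NoRootInFq P = ∀ x → Fq x → P x ≉ 0#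

  UniquelySolvable : Set
  UniquelySolvable =
    ∀ y → Fq y → ∃ λ x → (Fq x × Condition y x) × (∀ x′ → Fq x′ → Condition y x′ → x′ ≈ x)

  cubicForm : Carrier → Carrier → Carrier → Carrier → Carrier
  cubicForm α β w p = w * w * p + α * (w * w) * w + β * (p * p) * p

  cubicForm-cong : ∀ {α β w w′ p p′} → w ≈ w′ → p ≈ p′ →
                   cubicForm α β w p ≈ cubicForm α β w′ p′
  cubicForm-cong w≈w′ p≈p′ =
    +-cong (+-cong (*-cong (*-cong w≈w′ w≈w′) p≈p′) (*-cong (*-congˡ (*-cong w≈w′ w≈w′)) w≈w′))
           (*-cong (*-congˡ (*-cong p≈p′ p≈p′)) p≈p′)

  cubicForm-scale : ∀ α β l w p → cubicForm α β (l * w) (l * p) ≈ l * l * l * cubicForm α β w p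
  cubicForm-scale = solve 5 (λ α β l w p →
      (l :* w) :* (l :* w) :* (l :* p) :+ α :* ((l :* w) :* (l :* w)) :* (l :* w)
        :+ β :* ((l :* p) :* (l :* p)) :* (l :* p)
    := l :* l :* l :* (w :* w :* p :+ α :* (w :* w) :* w :+ β :* (p :* p) :* p)) refl

  cubicForm-diagonal : ∀ α β l → cubicForm α β l l ≈ l * (1# + α + β) * (l * l)
  cubicForm-diagonal = solve 3 (λ α β l →
    l :* l :* l :+ α :* (l :* l) :* l :+ β :* (l :* l) :* l := l :* (con 1₃ :+ α :+ β) :* (l :* l)) refl

  φ-cubicForm : ∀ α β w p → φ (cubicForm α β w p) ≈ cubicForm (φ α) (φ β) (φ w) (φ p)
  φ-cubicForm α β w p =
    trans (φ-+ _ _) (+-cong (trans (φ-+ _ _) (+-cong (φ-*³ w w p)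
                                                     (trans (φ-*³ α (w * w) w) (*-congʳ (*-congˡ (φ-* w w))))))
                            (trans (φ-*³ β (p * p) p) (*-congʳ (*-congˡ (φ-* p p)))))
    where
    φ-*³ : ∀ x y u → φ (x * y * u) ≈ φ x * φ y * φ u
    φ-*³ x y u = trans (φ-* (x * y) u) (*-congʳ (φ-* x y))

  f-cong : ∀ {x y} → x ≈ y → f x ≈ f y
  f-cong x≈y = *-cong x≈y (+-cong (+-congˡ (*-congˡ (^-congˡ (q *ℕ (q ∸ 1)) x≈y)))
                                  (*-congˡ (^-congˡ (2 *ℕ (q ∸ 1)) x≈y)))

  f-≈0 : ∀ {x} → x ≈ 0# → f x ≈ 0#
  f-≈0 x≈0 = trans (*-congʳ x≈0) (zeroˡ _)

  f-norm : ∀ w → f w * norm w ≈ cubicForm a b w (φ w)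
  f-norm w = begin
    f w * (w * φ w)
      ≈⟨ expand w a (w ^ (q *ℕ (q ∸ 1))) (w ^ (2 *ℕ (q ∸ 1))) (φ w) b ⟩
    w * w * φ w + a * (w * w) * (w ^ (q *ℕ (q ∸ 1)) * φ w) + b * (w ^ (2 *ℕ (q ∸ 1)) * (w * w)) * φ w
      ≈⟨ +-cong (+-congˡ (*-congˡ (^[q*[q∸1]]*φ≈id w))) (*-congʳ (*-congˡ (^[2*[q∸1]]*²≈φ² w))) ⟩
    cubicForm a b w (φ w) ∎
    where
    expand : ∀ w a u v p b → w * (1# + a * u + b * v) * (w * p)
                             ≈ w * w * p + a * (w * w) * (u * p) + b * (v * (w * w)) * p
    expand = solve 6 (λ w a u v p b →
         w :* (con 1₃ :+ a :* u :+ b :* v) :* (w :* p)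
      := w :* w :* p :+ a :* (w :* w) :* (u :* p) :+ b :* (v :* (w :* w)) :* p) refl

  norm≉0 : ∀ {w} → w ≉ 0# → norm w ≉ 0#
  norm≉0 w≉0 = *-nonzero w≉0 (φ-≉0 w≉0)

  f-Fq : ∀ {l} → Fq l → f l ≈ l * c
  f-Fq {l} Fl with l ≟ 0#
  ... | yes l≈0 = trans (f-≈0 l≈0) (sym (trans (*-congʳ l≈0) (zeroˡ c)))
  ... | no  l≉0 = *-cancelʳ (norm≉0 l≉0) (begin
    f l * norm l            ≈⟨ f-norm l ⟩
    cubicForm a b l (φ l)   ≈⟨ cubicForm-cong refl Fl ⟩
    cubicForm a b l l       ≈⟨ cubicForm-diagonal a b l ⟩
    l * c * (l * l)         ≈⟨ *-congˡ (*-congˡ Fl) ⟨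
    l * c * norm l          ∎)

  f-homogeneous : ∀ {l} → Fq l → ∀ w → f (l * w) ≈ l * f w
  f-homogeneous {l} Fl w with l ≟ 0# | w ≟ 0#
  ... | yes l≈0 | _       = trans (f-≈0 (trans (*-congʳ l≈0) (zeroˡ w)))
                                  (sym (trans (*-congʳ l≈0) (zeroˡ _)))
  ... | no  _   | yes w≈0 = trans (f-≈0 (trans (*-congˡ w≈0) (zeroʳ l)))
                                  (sym (trans (*-congˡ (f-≈0 w≈0)) (zeroʳ l)))
  ... | no  l≉0 | no  w≉0 = *-cancelʳ (norm≉0 (*-nonzero l≉0 w≉0)) (begin
    f (l * w) * norm (l * w)                 ≈⟨ f-norm (l * w) ⟩
    cubicForm a b (l * w) (φ (l * w))        ≈⟨ cubicForm-cong refl φ[lw]≈lφw ⟩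
    cubicForm a b (l * w) (l * φ w)          ≈⟨ cubicForm-scale a b l w (φ w) ⟩
    l * l * l * cubicForm a b w (φ w)        ≈⟨ *-congˡ (f-norm w) ⟨
    l * l * l * (f w * (w * φ w))            ≈⟨ regroup (f w) l w (φ w) ⟩
    l * f w * ((l * w) * (l * φ w))          ≈⟨ *-congˡ (*-congˡ φ[lw]≈lφw) ⟨
    l * f w * norm (l * w)                   ∎)
    where
    φ[lw]≈lφw : φ (l * w) ≈ l * φ w
    φ[lw]≈lφw = trans (φ-* l w) (*-congʳ Fl)
    regroup : ∀ F l w p → l * l * l * (F * (w * p)) ≈ l * F * ((l * w) * (l * p))
    regroup = solve 4 (λ F l w p → l :* l :* l :* (F :* (w :* p)) := l :* F :* ((l :* w) :* (l :* p))) refl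

  φ[x+z] : ∀ {x} → Fq x → φ (x + z) ≈ x + φ z
  φ[x+z] {x} Fx = trans (φ-+ x z) (+-congʳ Fx)

  x+z≉0 : ∀ {x} → Fq x → x + z ≉ 0#
  x+z≉0 Fx x+z≈0 = +-∉Fq z∉Fq Fx (Fq-resp (sym x+z≈0) Fq-0)

  z^[m*q] : ∀ m → z ^ (m *ℕ q) ≈ φ z ^ m
  z^[m*q] m = sym (trans (^-assocʳ z q m) (reflexive (≡.cong (z ^_) (ℕ.*-comm q m))))

  f-B : ∀ {x} → Fq x → f (x + z) * norm (x + z) ≈ B x
  f-B {x} Fx = begin
    f (x + z) * norm (x + z)                  ≈⟨ f-norm (x + z) ⟩
    cubicForm a b (x + z) (φ (x + z))         ≈⟨ cubicForm-cong refl (φ[x+z] Fx) ⟩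
    cubicForm a b (x + z) (x + φ z)           ≈⟨ expand x z (φ z) a b ⟩
    _                                         ≈⟨ +-congʳ (+-congˡ (*-congˡ (z^[m*q] 3))) ⟨
    B x                                       ∎
    where
    expand : ∀ x z z′ a b → cubicForm a b (x + z) (x + z′)
           ≈ (1# + a + b) * x ^ 3 + (- z + z′) * x ^ 2 + (z ^ 2 - z * z′) * x
             + a * z ^ 3 + b * z′ ^ 3 + z * (z * z′)
    expand = solve 5 (λ x z z′ a b →
         (x :+ z) :* (x :+ z) :* (x :+ z′) :+ a :* ((x :+ z) :* (x :+ z)) :* (x :+ z)
           :+ b :* ((x :+ z′) :* (x :+ z′)) :* (x :+ z′)
      := (con 1₃ :+ a :+ b) :* x :^ 3 :+ (:- z :+ z′) :* x :^ 2 :+ (z :^ 2 :- z :* z′) :* x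
           :+ a :* z :^ 3 :+ b :* z′ :^ 3 :+ z :* (z :* z′)) refl

  φ-B : ∀ {x} → Fq x → φ (B x) ≈ A x
  φ-B {x} Fx = begin
    φ (B x)                                        ≈⟨ φ-cong (f-B Fx) ⟨
    φ (f (x + z) * norm (x + z))                   ≈⟨ φ-cong (f-norm (x + z)) ⟩
    φ (cubicForm a b (x + z) (φ (x + z)))          ≈⟨ φ-cubicForm a b (x + z) (φ (x + z)) ⟩
    cubicForm (φ a) (φ b) (φ (x + z)) (φ (φ (x + z)))
                                                   ≈⟨ cubicForm-cong (φ[x+z] Fx) (φ-involutive (x + z)) ⟩
    cubicForm (φ a) (φ b) (x + φ z) (x + z)        ≈⟨ expand x z (φ z) (φ a) (φ b) ⟩
    _                                              ≈⟨ +-cong (+-cong (+-congʳ (+-congˡ (*-congʳ (+-congʳ (z^[m*q] 2)))))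
                                                                     (*-congˡ (z^[m*q] 3)))
                                                             (*-congˡ (z^[m*q] 2)) ⟨
    A x                                            ∎
    where
    expand : ∀ x z z′ a′ b′ → cubicForm a′ b′ (x + z′) (x + z)
           ≈ (1# + a′ + b′) * x ^ 3 + (z - z′) * x ^ 2 + (z′ ^ 2 - z * z′) * x
             + b′ * z ^ 3 + a′ * z′ ^ 3 + z * z′ ^ 2
    expand = solve 5 (λ x z z′ a′ b′ →
         (x :+ z′) :* (x :+ z′) :* (x :+ z) :+ a′ :* ((x :+ z′) :* (x :+ z′)) :* (x :+ z′)
           :+ b′ :* ((x :+ z) :* (x :+ z)) :* (x :+ z)
      := (con 1₃ :+ a′ :+ b′) :* x :^ 3 :+ (z :- z′) :* x :^ 2 :+ (z′ :^ 2 :- z :* z′) :* x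
           :+ b′ :* z :^ 3 :+ a′ :* z′ :^ 3 :+ z :* z′ :^ 2) refl

  hits⇒condition : ∀ {y s x} → Fq y → Fq s → s ≉ 0# → Fq x →
                   f (s * (x + z)) * φ c ≈ y + z → Condition y x
  hits⇒condition {y} {s} {x} Fy Fs s≉0 Fx hit = x*y≈0⇒y≈0 s≉0 (begin
    s * (c * A x * (y + z) - φ c * B x * (y + φ z))   ≈⟨ distribute s c (A x) (y + z) (φ c) (B x) (y + φ z) ⟩
    s * A x * c * (y + z) - s * B x * φ c * (y + φ z) ≈⟨ +-cong (*-congʳ sAc≈[y+φz]N)
                                                                (-‿cong (*-congʳ sBφc≈[y+z]N)) ⟩
    (y + φ z) * N * (y + z) - (y + z) * N * (y + φ z) ≈⟨ cancel (y + z) (y + φ z) N ⟩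
    0#                                                ∎)
    where
    N : Carrier
    N = norm (x + z)
    sBφc≈[y+z]N : s * B x * φ c ≈ (y + z) * N
    sBφc≈[y+z]N = begin
      s * B x * φ c                 ≈⟨ *-congʳ (*-congˡ (f-B Fx)) ⟨
      s * (f (x + z) * N) * φ c     ≈⟨ solve 4 (λ s F N c → s :* (F :* N) :* c := s :* F :* c :* N)
                                              refl s (f (x + z)) N (φ c) ⟩
      s * f (x + z) * φ c * N       ≈⟨ *-congʳ (*-congʳ (f-homogeneous Fs (x + z))) ⟨
      f (s * (x + z)) * φ c * N     ≈⟨ *-congʳ hit ⟩
      (y + z) * N                   ∎
    sAc≈[y+φz]N : s * A x * c ≈ (y + φ z) * N
    sAc≈[y+φz]N = begin
      s * A x * c                   ≈⟨ *-cong (*-cong Fs (φ-B Fx)) (φ-involutive c) ⟨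
      φ s * φ (B x) * φ (φ c)       ≈⟨ trans (φ-* _ _) (*-congʳ (φ-* s (B x))) ⟨
      φ (s * B x * φ c)             ≈⟨ φ-cong sBφc≈[y+z]N ⟩
      φ ((y + z) * N)               ≈⟨ trans (φ-* _ _) (*-cong (φ[x+z] Fy) (Fq-norm (x + z))) ⟩
      (y + φ z) * N                 ∎
    distribute : ∀ s c A Y c′ B Y′ → s * (c * A * Y - c′ * B * Y′) ≈ s * A * c * Y - s * B * c′ * Y′
    distribute = solve 7 (λ s c A Y c′ B Y′ →
      s :* (c :* A :* Y :- c′ :* B :* Y′) := s :* A :* c :* Y :- s :* B :* c′ :* Y′) refl
    cancel : ∀ Y Y′ N → Y′ * N * Y - Y * N * Y′ ≈ 0#
    cancel = solve 3 (λ Y Y′ N → Y′ :* N :* Y :- Y :* N :* Y′ := con 0₃) refl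

  -- Condition y x says exactly that l = N (y + z) / (φ c B x) is fixed by φ.
  condition⇒hits : ∀ {y x} → Fq y → Fq x → c ≉ 0# → B x ≉ 0# → Condition y x →
                   ∃ λ l → Fq l × f (l * (x + z)) * φ c ≈ y + z
  condition⇒hits {y} {x} Fy Fx c≉0 Bx≉0 cond = l , Fl , hit
    where
    N K : Carrier
    N = norm (x + z)
    K = φ c * B x
    K≉0 : K ≉ 0#
    K≉0 = *-nonzero (φ-≉0 c≉0) Bx≉0
    K⁻¹ l : Carrier
    K⁻¹ = K ⁻¹⟨ K≉0 ⟩
    l = N * (y + z) * K⁻¹
    Fl : Fq l
    Fl = Fq-/ K≉0 (begin
      N * (y + z) * φ K             ≈⟨ *-congˡ (trans (φ-* (φ c) (B x))
                                                      (*-cong (φ-involutive c) (φ-B Fx))) ⟩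
      N * (y + z) * (c * A x)       ≈⟨ xy∙z≈x∙zy N (y + z) (c * A x) ⟩
      N * (c * A x * (y + z))       ≈⟨ *-congˡ (x∙y⁻¹≈ε⇒x≈y _ _ cond) ⟩
      N * (K * (y + φ z))           ≈⟨ x∙yz≈xz∙y N K (y + φ z) ⟩
      N * (y + φ z) * K             ≈⟨ *-congʳ (trans (φ-* N (y + z))
                                                      (*-cong (Fq-norm (x + z)) (φ[x+z] Fy))) ⟨
      φ (N * (y + z)) * K           ∎)
    hit : f (l * (x + z)) * φ c ≈ y + z
    hit = begin
      f (l * (x + z)) * φ c                ≈⟨ *-congʳ (f-homogeneous Fl (x + z)) ⟩
      N * (y + z) * K⁻¹ * f (x + z) * φ c   ≈⟨ solve 5 (λ N Y K F c → N :* Y :* K :* F :* c := Y :* K :* (F :* N :* c))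
                                                      refl N (y + z) K⁻¹ (f (x + z)) (φ c) ⟩
      (y + z) * K⁻¹ * (f (x + z) * N * φ c) ≈⟨ *-congˡ (trans (*-congʳ (f-B Fx)) (*-comm (B x) (φ c))) ⟩
      (y + z) * K⁻¹ * K                    ≈⟨ *-inverse-cancelʳ (y + z) K≉0 ⟩
      y + z                                ∎

  coordinates-unique : ∀ {l l′ x x′} → Fq l → Fq l′ → Fq x → Fq x′ → l ≉ 0# →
                       l * (x + z) ≈ l′ * (x′ + z) → x ≈ x′
  coordinates-unique {l} {l′} {x} {x′} Fl Fl′ Fx Fx′ l≉0 eq =
    +-cancelʳ z x x′ (*-cancelʳ l≉0 (trans (*-comm _ l) (trans eq (trans (*-congʳ (sym l≈l′)) (*-comm l _)))))
    where
    l≈l′ : l ≈ l′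
    l≈l′ = x∙y⁻¹≈ε⇒x≈y l l′ (*z∈Fq⇒≈0 z∉Fq (Fq-+ Fl (Fq-‿ Fl′)) (Fq-+ (Fq-* Fl′ Fx′) (Fq-‿ (Fq-* Fl Fx))) (begin
      (l - l′) * z                                          ≈⟨ solve 5 (λ l l′ x x′ z →
                                                                  (l :- l′) :* z
                                                               := (l′ :* x′ :- l :* x) :+ (l :* (x :+ z) :- l′ :* (x′ :+ z)))
                                                               refl l l′ x x′ z ⟩
      (l′ * x′ - l * x) + (l * (x + z) - l′ * (x′ + z))     ≈⟨ +-congˡ (x≈y⇒x∙y⁻¹≈ε eq) ⟩
      (l′ * x′ - l * x) + 0#                                ≈⟨ +-identityʳ _ ⟩
      l′ * x′ - l * x                                       ∎))

  injective⇒c≉0 : (∀ x y → f x ≈ f y → x ≈ y) → c ≉ 0#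
  injective⇒c≉0 f-injective c≈0 =
    1≉0 (f-injective 1# 0# (trans (f-Fq Fq-1) (trans (*-identityˡ c) (trans c≈0 (sym (f-≈0 refl))))))

  injective⇒noRoot : (∀ x y → f x ≈ f y → x ≈ y) → NoRootInFq B
  injective⇒noRoot f-injective x Fx Bx≈0 =
    x+z≉0 Fx (f-injective (x + z) 0# (trans f[x+z]≈0 (sym (f-≈0 refl))))
    where
    f[x+z]≈0 : f (x + z) ≈ 0#
    f[x+z]≈0 = *-cancelʳ (norm≉0 (x+z≉0 Fx)) (trans (f-B Fx) (trans Bx≈0 (sym (zeroˡ _))))

  -- A preimage of (y + z) / φ c cannot lie in F_q, since f maps F_q into F_q.
  surjective⇒solvable : c ≉ 0# → (∀ t → ∃ λ v → f v ≈ t) →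
                        ∀ y → Fq y → ∃ λ x → Fq x × Condition y x
  surjective⇒solvable c≉0 f-surjective y Fy = solve-from (decompose z∉Fq v)
    where
    v : Carrier
    v = proj₁ (f-surjective ((y + z) * φ c ⁻¹⟨ φ-≉0 c≉0 ⟩))
    fvφc≈y+z : f v * φ c ≈ y + z
    fvφc≈y+z = trans (*-congʳ (proj₂ (f-surjective _))) (*-inverse-cancelʳ (y + z) (φ-≉0 c≉0))
    solve-from : Fq v ⊎ ScaledShift z∉Fq v → ∃ λ x → Fq x × Condition y x
    solve-from (inj₁ Fv) =
      ⊥-elim (+-∉Fq z∉Fq Fy (Fq-resp fvφc≈y+z (Fq-resp fvφc≈v*normc (Fq-* Fv (Fq-norm c)))))
      where
      fvφc≈v*normc : v * norm c ≈ f v * φ c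
      fvφc≈v*normc = trans (sym (*-assoc v c (φ c))) (*-congʳ (sym (f-Fq Fv)))
    solve-from (inj₂ (s , x , Fs , s≉0 , Fx , v≈s[x+z])) =
      x , Fx , hits⇒condition Fy Fs s≉0 Fx (trans (*-congʳ (f-cong (sym v≈s[x+z]))) fvφc≈y+z)

  hit-multiplier≉0 : ∀ {l y w} → Fq y → f (l * w) * φ c ≈ y + z → l ≉ 0#
  hit-multiplier≉0 {l} {y} {w} Fy hit l≈0 =
    x+z≉0 Fy (trans (sym hit) (trans (*-congʳ (f-≈0 (trans (*-congʳ l≈0) (zeroˡ w)))) (zeroˡ (φ c))))

  injective⇒unique : (∀ x y → f x ≈ f y → x ≈ y) →
                     ∀ {y x x′} → Fq y → Fq x → Fq x′ → Condition y x → Condition y x′ → x′ ≈ x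
  injective⇒unique f-injective {y} {x} {x′} Fy Fx Fx′ cond cond′ =
    let c≉0 = injective⇒c≉0 f-injective
        l , Fl , hit = condition⇒hits Fy Fx c≉0 (injective⇒noRoot f-injective x Fx) cond
        l′ , Fl′ , hit′ = condition⇒hits Fy Fx′ c≉0 (injective⇒noRoot f-injective x′ Fx′) cond′
    in sym (coordinates-unique Fl Fl′ Fx Fx′ (hit-multiplier≉0 Fy hit)
             (f-injective _ _ (*-cancelʳ (φ-≉0 c≉0) (trans hit (sym hit′)))))

  -- If c ≈ 0, every x solves the condition.
  unique⇒c≉0 : UniquelySolvable → c ≉ 0#
  unique⇒c≉0 unique c≈0 = 1≉0 (trans (only 1# Fq-1 (trivial 1#)) (sym (only 0# Fq-0 (trivial 0#))))
    where
    only : ∀ x → Fq x → Condition 0# x → x ≈ proj₁ (unique 0# Fq-0)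
    only = proj₂ (proj₂ (unique 0# Fq-0))
    ≈0⇒*≈0 : ∀ {u} v w → u ≈ 0# → u * v * w ≈ 0#
    ≈0⇒*≈0 v w u≈0 = trans (*-congʳ (trans (*-congʳ u≈0) (zeroˡ v))) (zeroˡ w)
    trivial : ∀ x → Condition 0# x
    trivial x = trans (+-cong (≈0⇒*≈0 _ _ c≈0) (-‿cong (≈0⇒*≈0 _ _ (trans (φ-cong c≈0) φ-0))))
                      (-‿inverseʳ 0#)

  solvable⇒surjective : c ≉ 0# → NoRootInFq B → (∀ y → Fq y → ∃ λ x → Fq x × Condition y x) →
                        ∀ t → ∃ λ v → f v ≈ t
  solvable⇒surjective c≉0 noRoot solvable t = preimage (decompose z∉Fq (φ c * t))
    where
    φc≉0 : φ c ≉ 0#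
    φc≉0 = φ-≉0 c≉0
    preimage : Fq (φ c * t) ⊎ ScaledShift z∉Fq (φ c * t) → ∃ λ v → f v ≈ t
    preimage (inj₁ Fφct) = v , *-cancelʳ φc≉0 (begin
      f v * φ c               ≈⟨ *-congʳ (f-Fq Fv) ⟩
      v * c * φ c             ≈⟨ *-assoc v c (φ c) ⟩
      v * norm c              ≈⟨ *-inverse-cancelʳ (φ c * t) (norm≉0 c≉0) ⟩
      φ c * t                 ≈⟨ *-comm (φ c) t ⟩
      t * φ c                 ∎)
      where
      v : Carrier
      v = φ c * t * norm c ⁻¹⟨ norm≉0 c≉0 ⟩
      Fv : Fq v
      Fv = Fq-* Fφct (Fq-inverse (norm≉0 c≉0) (Fq-norm c))
    preimage (inj₂ (s , y , Fs , s≉0 , Fy , φct≈s[y+z])) =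
      let x , Fx , cond = solvable y Fy
          l , Fl , hit = condition⇒hits Fy Fx c≉0 (noRoot x Fx) cond
      in s * (l * (x + z)) , *-cancelʳ φc≉0 (begin
        f (s * (l * (x + z))) * φ c     ≈⟨ *-congʳ (f-homogeneous Fs (l * (x + z))) ⟩
        s * f (l * (x + z)) * φ c       ≈⟨ *-assoc s _ (φ c) ⟩
        s * (f (l * (x + z)) * φ c)     ≈⟨ *-congˡ hit ⟩
        s * (y + z)                     ≈⟨ φct≈s[y+z] ⟨
        φ c * t                         ≈⟨ *-comm (φ c) t ⟩
        t * φ c                         ∎)

  permutation⇒criterion : IsPermutation f → NoRootInFq B × UniquelySolvable
  permutation⇒criterion (f-injective , f-surjective) = injective⇒noRoot f-injective , λ y Fy →
    let x , Fx , cond = surjective⇒solvable (injective⇒c≉0 f-injective) f-surjective y Fy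
    in x , (Fx , cond) , λ x′ Fx′ cond′ → injective⇒unique f-injective Fy Fx Fx′ cond cond′

  criterion⇒permutation : NoRootInFq B × UniquelySolvable → IsPermutation f
  criterion⇒permutation (noRoot , unique) = surjective⇒injective f f-cong f-surjective , f-surjective
    where
    f-surjective : ∀ t → ∃ λ v → f v ≈ t
    f-surjective = solvable⇒surjective (unique⇒c≉0 unique) noRoot
      λ y Fy → let x , (Fx , cond) , _ = unique y Fy in x , Fx , cond

proposition2p1 : (R : CommutativeRing 0ℓ 0ℓ) → let open FF R in
    (q : ℕ) → (∃ λ k → q ≡ 3 ^ℕ k) →
    IsField → Char3 → HasSize (q *ℕ q) →
    (a b : Carrier) → ¬ (a ≈ 0#) → ¬ (b ≈ 0#) →
    (z : Carrier) → ¬ InSubfield q z →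
    (IsPermutation (fPoly q a b) →
      (∀ x → InSubfield q x → ¬ (BPoly q a b z x ≈ 0#))
      × (∀ y → InSubfield q y → ∃ λ x → (InSubfield q x
           × ((1# + a + b) * APoly q a b z x * (y + z) - (1# + a + b) ^ q * BPoly q a b z x * (y + z ^ q) ≈ 0#))
           × (∀ x′ → InSubfield q x′
                → (1# + a + b) * APoly q a b z x′ * (y + z) - (1# + a + b) ^ q * BPoly q a b z x′ * (y + z ^ q) ≈ 0#
                → x′ ≈ x)))
    × (((∀ x → InSubfield q x → ¬ (BPoly q a b z x ≈ 0#))
      × (∀ y → InSubfield q y → ∃ λ x → (InSubfield q x
           × ((1# + a + b) * APoly q a b z x * (y + z) - (1# + a + b) ^ q * BPoly q a b z x * (y + z ^ q) ≈ 0#))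
           × (∀ x′ → InSubfield q x′
                → (1# + a + b) * APoly q a b z x′ * (y + z) - (1# + a + b) ^ q * BPoly q a b z x′ * (y + z ^ q) ≈ 0#
                → x′ ≈ x)))
      → IsPermutation (fPoly q a b))
proposition2p1 R q (k , q≡3^k) isField char3 size a b _ _ z z∉Fq =
  permutation⇒criterion , criterion⇒permutation
  where open PermutationCriterion R isField char3 {k = k} q≡3^k size a b z z∉Fq
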